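{- Let $G=(V,E)$ be a finite simple graph with a vertex cut $C$. Let $V_1$ be the vertex set of one of the connected components of $G-C$, let $V_2=V\setminus(V_1\cup C)$, and let $G_1=G[V_1\cup C]$ and $G_2=G[V_2\cup C]$. If $A_1$ and $A_2$ are forcing arc sets of $G_1$ and $G_2$, respectively, such that every vertex of $C$ is a source of both $A_1$ and $A_2$, then $A_1\cup\overleftarrow{A_2}$ is a forcing arc set of $G$.
   Context: Zero forcing: a blue vertex $u$ may force a white neighbour $v$ if $v$ is the only white vertex in $N[u]$. An arc set of a graph $G=(V,E)$ is a set $A$ of ordered pairs $(u,v)$ with $uv\in E$ such that $(u,v)\in A$ implies $(v,u)\notin A$; a source of $A$ is a vertex of in-degree zero in $(V,A)$. $A$ is a forcing arc set of $G$ if $(V,A)$ is a collection of vertex-disjoint directed paths (possibly of length zero) and there is a zero forcing process on $G$ starting from the sources of $A$, with each white vertex forced by exactly one vertex and all vertices ending blue, such that $(u,v)\in A$ exactly when $u$ forces $v$. The reverse of $A$ is $\overleftarrow{A}=\{(v,u):(u,v)\in A\}$. -}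

module Defs where

open import Data.Nat using (ℕ)
open import Data.Fin using (Fin)
open import Data.Product using (Σ; _×_; _,_; proj₁; proj₂)
open import Data.Sum using (_⊎_)
open import Data.Unit using (⊤)
open import Data.List using (List; []; _∷_)
open import Data.List.Membership.Propositional using (_∈_)
open import Relation.Nullary using (¬_)
open import Relation.Binary.PropositionalEquality using (_≡_; _≢_)
open import Relation.Binary.Construct.Closure.Transitive using (TransClosure)
open import Relation.Binary.Construct.Closure.ReflexiveTransitive using (Star)
open import Function.Bundles using (_⇔_)

-- A finite simple graph whose vertex set V is a subset of Fin n
-- (the ambient type Fin n is just a finite supply of vertex names).
-- Edges form a symmetric irreflexive relation on V.
record Graph (n : ℕ) : Set₁ where
  field
    V     : Fin n → Set
    E     : Fin n → Fin n → Set
    E-sym : ∀ {u v} → E u v → E v u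
    E-irr : ∀ {u} → ¬ E u u
    E-V   : ∀ {u v} → E u v → V u
open Graph public

VSet : ℕ → Set₁
VSet n = Fin n → Set

_[_] : ∀ {n} → Graph n → VSet n → Graph n
G [ S ] = record
  { V     = λ x → V G x × S x
  ; E     = λ u v → E G u v × S u × S v
  ; E-sym = λ { (e , su , sv) → E-sym G e , sv , su }
  ; E-irr = λ { (e , _ , _) → E-irr G e }
  ; E-V   = λ { (e , su , _) → E-V G e , su }
  }

_─_ : ∀ {n} → Graph n → VSet n → Graph n
G ─ C = G [ (λ x → ¬ C x) ]

Connected : ∀ {n} → Graph n → Fin n → Fin n → Set
Connected G = Star (E G)

Component : ∀ {n} → Graph n → Fin n → VSet n
Component G r x = V G x × Connected G r x

IsVertexCut : ∀ {n} → Graph n → VSet n → Set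
IsVertexCut G C =
  (∀ x → C x → V G x) ×
  Σ _ λ x → Σ _ λ y → V (G ─ C) x × V (G ─ C) y × ¬ Connected (G ─ C) x y

-- arc sets are relations on vertices: A u v means (u,v) ∈ A
Arcs : ℕ → Set₁
Arcs n = Fin n → Fin n → Set

IsArcSet : ∀ {n} → Graph n → Arcs n → Set
IsArcSet G A = ∀ u v → A u v → E G u v × ¬ A v u

rev : ∀ {n} → Arcs n → Arcs n
rev A u v = A v u

_∪A_ : ∀ {n} → Arcs n → Arcs n → Arcs n
(A ∪A B) u v = A u v ⊎ B u v

Source : ∀ {n} → Graph n → Arcs n → VSet n
Source G A x = V G x × (∀ u → ¬ A u x)

-- (V, A) is a collection of vertex-disjoint directed paths:
-- in-degree ≤ 1, out-degree ≤ 1, and no directed cycle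
IsPathCollection : ∀ {n} → Arcs n → Set
IsPathCollection A =
  (∀ u u' v → A u v → A u' v → u ≡ u') ×
  (∀ u v v' → A u v → A u v' → v ≡ v') ×
  (∀ v → ¬ TransClosure A v v)

-- A zero forcing process given as the list of forces (u , v) ("u forces v")
-- in chronological order, starting from the blue set B.
ValidForcing : ∀ {n} → Graph n → VSet n → List (Fin n × Fin n) → Set
ValidForcing G B [] = ⊤
ValidForcing G B ((u , v) ∷ fs) =
  B u × ¬ B v × E G u v × (∀ w → E G u w → w ≢ v → B w) ×
  ValidForcing G (λ x → B x ⊎ x ≡ v) fs

AllBlue : ∀ {n} → Graph n → VSet n → List (Fin n × Fin n) → Set
AllBlue G B fs = ∀ x → V G x → B x ⊎ Σ _ λ u → (u , x) ∈ fs

IsForcingArcSet : ∀ {n} → Graph n → Arcs n → Set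
IsForcingArcSet G A =
  IsArcSet G A × IsPathCollection A ×
  Σ (List _) λ fs →
    ValidForcing G (Source G A) fs × AllBlue G (Source G A) fs ×
    (∀ u v → A u v ⇔ ((u , v) ∈ fs))

-- Run the reversal of the G₂-process first. Reversing a zero forcing process
-- gives a zero forcing process started from the vertices that never force, and
-- no vertex of V₂ has a neighbour in V₁, so this colours all of V₂ ∪ C in G.
-- Every vertex of C is then blue, and the G₁-process runs unchanged in G: the
-- only neighbours of its forcers outside V₁ ∪ C lie in V₂ and are already blue.
-- The arcs of A₁ and of the reverse of A₂ meet only in C, where A₁ has no
-- incoming and the reverse of A₂ no outgoing arcs, so the paths just concatenate.
module Submission where

open import Defs
open import Data.Nat using (ℕ)
open import Data.Fin using (Fin; _≟_)
open import Data.Product using (_×_; Σ; _,_; proj₁; proj₂; swap)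
open import Data.Sum using (_⊎_; inj₁; inj₂; [_,_]′) renaming (map₁ to ⊎-map₁)
open import Data.Unit using (tt)
open import Data.Empty using (⊥-elim)
open import Data.List using (List; []; _∷_; _++_)
open import Data.List.Properties using (++-assoc)
open import Data.List.Membership.Propositional using (_∈_; _∉_)
open import Data.List.Membership.Propositional.Properties using (∈-++⁺ˡ; ∈-++⁺ʳ; ∈-++⁻; ∈-∃++)
open import Data.List.Relation.Unary.Any using (here; there)
open import Relation.Nullary using (¬_; Dec; yes; no)
open import Relation.Nullary.Negation using (Stable)
open import Relation.Nullary.Decidable using (map′)
open import Relation.Unary using (_⊆_; _≐_; _∪_)
open import Relation.Binary.PropositionalEquality using (_≡_; _≢_; refl; sym; trans; cong; subst)
open import Relation.Binary.Construct.Closure.Transitive using (TransClosure; _∷ʳ_) renaming ([_] to [_]⁺; _∷_ to _∷⁺_)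
open import Relation.Binary.Construct.Closure.ReflexiveTransitive using (ε; _◅_; _◅◅_)
open import Function using (_∘_; case_of_)
open import Function.Bundles using (_⇔_; mk⇔; Equivalence)

open Equivalence using (to; from)

ForcingList : ℕ → Set
ForcingList n = List (Fin n × Fin n)

BlueAfter : ∀ {n} → VSet n → ForcingList n → VSet n
BlueAfter B fs x = B x ⊎ Σ _ λ u → (u , x) ∈ fs

CanForce : ∀ {n} → Graph n → VSet n → Fin n → Fin n → Set
CanForce G B u v = B u × ¬ B v × E G u v × (∀ w → E G u w → w ≢ v → B w)

NonForcing : ∀ {n} → Graph n → ForcingList n → VSet n
NonForcing G fs x = V G x × ∀ y → (x , y) ∉ fs

reverseForces : ∀ {n} → ForcingList n → ForcingList n
reverseForces [] = []
reverseForces ((u , v) ∷ fs) = reverseForces fs ++ (v , u) ∷ []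

StableOn : ∀ {n} → VSet n → VSet n → Set
StableOn U B = ∀ x → U x → Stable (B x)

module _ {n : ℕ} where

  ∈-reverseForces⁺ : ∀ {fs : ForcingList n} {u v} → (u , v) ∈ fs → (v , u) ∈ reverseForces fs
  ∈-reverseForces⁺ {fs = _ ∷ fs} (here refl) = ∈-++⁺ʳ (reverseForces fs) (here refl)
  ∈-reverseForces⁺ {fs = _ ∷ fs} (there m)   = ∈-++⁺ˡ (∈-reverseForces⁺ m)

  ∈-reverseForces⁻ : ∀ (fs : ForcingList n) {u v} → (v , u) ∈ reverseForces fs → (u , v) ∈ fs
  ∈-reverseForces⁻ (_ ∷ fs) m with ∈-++⁻ (reverseForces fs) m
  ... | inj₁ m′        = there (∈-reverseForces⁻ fs m′)
  ... | inj₂ (here refl) = here refl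

  forced? : ∀ x (fs : ForcingList n) → Dec (Σ _ λ u → (u , x) ∈ fs)
  forced? x [] = no λ ()
  forced? x ((u , v) ∷ fs) with v ≟ x | forced? x fs
  ... | yes refl | _           = yes (u , here refl)
  ... | no _     | yes (w , m) = yes (w , there m)
  ... | no v≢x   | no unforced = no λ
    { (_ , here eq)  → v≢x (sym (cong proj₂ eq))
    ; (w , there m) → unforced (w , m) }

  forces? : ∀ x (fs : ForcingList n) → Dec (Σ _ λ v → (x , v) ∈ fs)
  forces? x fs = map′ (λ (v , m) → v , ∈-reverseForces⁻ fs m)
                      (λ (v , m) → v , ∈-reverseForces⁺ m)
                      (forced? x (reverseForces fs))

  blueAfter-[] : ∀ {B : VSet n} → BlueAfter B [] ≐ B
  blueAfter-[] = [ (λ b → b) , (λ ()) ∘ proj₂ ]′ , inj₁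

  blueAfter-∷ : ∀ {B : VSet n} {u v fs} → BlueAfter B ((u , v) ∷ fs) ≐ BlueAfter (B ∪ (_≡ v)) fs
  blueAfter-∷ = [ inj₁ ∘ inj₁ , (λ { (_ , here refl) → inj₁ (inj₂ refl) ; (w , there m) → inj₂ (w , m) }) ]′
              , [ [ inj₁ , (λ { refl → inj₂ (_ , here refl) }) ]′ , (λ (w , m) → inj₂ (w , there m)) ]′

  blueAfter-++ : ∀ {B : VSet n} P R → BlueAfter B P ⊆ BlueAfter B (P ++ R)
  blueAfter-++ P R = [ inj₁ , (λ (u , m) → inj₂ (u , ∈-++⁺ˡ m)) ]′

  stable-∪≡ : ∀ {U B : VSet n} {v} → StableOn U B → StableOn U (B ∪ (_≡ v))
  stable-∪≡ {v = v} stable x ux ¬¬b with x ≟ v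
  ... | yes x≡v = inj₂ x≡v
  ... | no x≢v  = inj₁ (stable x ux λ ¬bx → ¬¬b [ ¬bx , x≢v ]′)

  stable-blueAfter : ∀ {U B : VSet n} {fs} → StableOn U B → StableOn U (BlueAfter B fs)
  stable-blueAfter {fs = fs} stable x ux ¬¬b with forced? x fs
  ... | yes f       = inj₂ f
  ... | no unforced = inj₁ (stable x ux λ ¬bx → ¬¬b [ ¬bx , unforced ]′)

  stable-source : ∀ {G : Graph n} {A} → StableOn (V G) (Source G A)
  stable-source _ vx ¬¬s = vx , λ u a → ¬¬s λ (_ , noIn) → noIn u a

module _ {n : ℕ} {G : Graph n} where

  canForce-resp : ∀ {B B′ : VSet n} {u v} → B ≐ B′ → CanForce G B u v → CanForce G B′ u v
  canForce-resp (B⊆B′ , B′⊆B) (bu , ¬bv , e , nbrs) =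
    B⊆B′ bu , ¬bv ∘ B′⊆B , e , λ w e′ w≢v → B⊆B′ (nbrs w e′ w≢v)

  valid-resp : ∀ {B B′ : VSet n} fs → B ≐ B′ → ValidForcing G B fs → ValidForcing G B′ fs
  valid-resp [] _ _ = tt
  valid-resp (_ ∷ fs) (B⊆B′ , B′⊆B) (bu , ¬bv , e , nbrs , rest) =
    B⊆B′ bu , ¬bv ∘ B′⊆B , e , (λ w e′ w≢v → B⊆B′ (nbrs w e′ w≢v)) ,
    valid-resp fs (⊎-map₁ B⊆B′ , ⊎-map₁ B′⊆B) rest

  valid-singleton : ∀ {B : VSet n} {u v} → CanForce G B u v → ValidForcing G B ((u , v) ∷ [])
  valid-singleton (bu , ¬bv , e , nbrs) = bu , ¬bv , e , nbrs , tt

  valid-++ : ∀ {B : VSet n} fs gs →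
             ValidForcing G B fs → ValidForcing G (BlueAfter B fs) gs → ValidForcing G B (fs ++ gs)
  valid-++ [] gs _ valid = valid-resp gs blueAfter-[] valid
  valid-++ (_ ∷ fs) gs (bu , ¬bv , e , nbrs , rest) valid =
    bu , ¬bv , e , nbrs , valid-++ fs gs rest (valid-resp gs blueAfter-∷ valid)

  valid-++⁻ˡ : ∀ {B : VSet n} fs {gs} → ValidForcing G B (fs ++ gs) → ValidForcing G B fs
  valid-++⁻ˡ [] _ = tt
  valid-++⁻ˡ (_ ∷ fs) (bu , ¬bv , e , nbrs , rest) = bu , ¬bv , e , nbrs , valid-++⁻ˡ fs rest

  valid⇒canForce : ∀ {B : VSet n} P {u v} Q →
                   ValidForcing G B (P ++ (u , v) ∷ Q) → CanForce G (BlueAfter B P) u v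
  valid⇒canForce [] Q (bu , ¬bv , e , nbrs , _) = canForce-resp (swap blueAfter-[]) (bu , ¬bv , e , nbrs)
  valid⇒canForce (_ ∷ P) Q (_ , _ , _ , _ , rest) = canForce-resp (swap blueAfter-∷) (valid⇒canForce P Q rest)

  closedNbhd-blueAfter : ∀ {B : VSet n} P {x y w} → ValidForcing G B P → (x , y) ∈ P →
                         x ≡ w ⊎ E G x w → BlueAfter B P w
  closedNbhd-blueAfter {B} P {x} {y} valid m near with ∈-∃++ m
  ... | P₁ , P₂ , refl = blue near
    where
    canForce : CanForce G (BlueAfter B P₁) x y
    canForce = valid⇒canForce P₁ P₂ valid
    blue : ∀ {w} → x ≡ w ⊎ E G x w → BlueAfter B (P₁ ++ (x , y) ∷ P₂) w
    blue (inj₁ refl) = blueAfter-++ {B = B} P₁ _ (proj₁ canForce)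
    blue {w} (inj₂ e) with w ≟ y
    ... | yes refl = inj₂ (x , ∈-++⁺ʳ P₁ (here refl))
    ... | no w≢y   = blueAfter-++ {B = B} P₁ _ (proj₂ (proj₂ (proj₂ canForce)) w e w≢y)

  forces-once : ∀ {B : VSet n} P {u v} Q {y} → ValidForcing G B (P ++ (u , v) ∷ Q) → (u , y) ∉ Q
  forces-once {B} P {u} {v} Q {y} valid m with ∈-∃++ m
  ... | Q₁ , Q₂ , refl = ¬by (closedNbhd-blueAfter P′ (valid-++⁻ˡ P′ valid′) (∈-++⁺ʳ P (here refl)) (inj₂ e))
    where
    P′ = P ++ (u , v) ∷ Q₁
    valid′ : ValidForcing G B (P′ ++ (u , y) ∷ Q₂)
    valid′ = subst (ValidForcing G B) (sym (++-assoc P ((u , v) ∷ Q₁) ((u , y) ∷ Q₂))) valid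
    canForce : CanForce G (BlueAfter B P′) u y
    canForce = valid⇒canForce P′ Q₂ valid′
    ¬by : ¬ BlueAfter B P′ y
    ¬by = proj₁ (proj₂ canForce)
    e : E G u y
    e = proj₁ (proj₂ (proj₂ canForce))

  reverse-canForce : ∀ {B : VSet n} {fs} P {u v} Q → fs ≡ P ++ (u , v) ∷ Q → ValidForcing G B fs →
                     CanForce G (BlueAfter (NonForcing G fs) (reverseForces Q)) v u
  reverse-canForce {B} P {u} {v} Q refl valid =
    blue (inj₁ refl) (λ v≡u → E-irr G (subst (E G u) v≡u e)) , white , E-sym G e ,
    λ w e′ → blue (inj₂ (E-sym G e′))
    where
    canForce : CanForce G (BlueAfter B P) u v
    canForce = valid⇒canForce P Q valid
    ¬bv : ¬ BlueAfter B P v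
    ¬bv = proj₁ (proj₂ canForce)
    e : E G u v
    e = proj₁ (proj₂ (proj₂ canForce))
    -- A vertex of N[v] that forced before u forced v would have made v blue already.
    nonForcing : ∀ {w} → w ≡ v ⊎ E G w v → w ≢ u → (∀ z → (w , z) ∉ Q) →
                 NonForcing G (P ++ (u , v) ∷ Q) w
    nonForcing near w≢u idle =
      [ (λ { refl → E-V G (E-sym G e) }) , E-V G ]′ near ,
      λ z m → case ∈-++⁻ P m of λ
        { (inj₁ inP)       → ¬bv (closedNbhd-blueAfter P (valid-++⁻ˡ P valid) inP near)
        ; (inj₂ (here eq)) → w≢u (cong proj₁ eq)
        ; (inj₂ (there m′)) → idle z m′ }
    blue : ∀ {w} → w ≡ v ⊎ E G w v → w ≢ u → BlueAfter (NonForcing G (P ++ (u , v) ∷ Q)) (reverseForces Q) w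
    blue {w} near w≢u with forces? w Q
    ... | yes (z , m) = inj₂ (z , ∈-reverseForces⁺ m)
    ... | no idle     = inj₁ (nonForcing near w≢u λ z m → idle (z , m))
    white : ¬ BlueAfter (NonForcing G (P ++ (u , v) ∷ Q)) (reverseForces Q) u
    white (inj₁ (_ , idle)) = idle v (∈-++⁺ʳ P (here refl))
    white (inj₂ (y , m))    = forces-once P Q valid (∈-reverseForces⁻ Q m)

  reverse-valid : ∀ {B : VSet n} fs → ValidForcing G B fs → ValidForcing G (NonForcing G fs) (reverseForces fs)
  reverse-valid fs valid = suffix [] fs refl
    where
    suffix : ∀ P S → fs ≡ P ++ S → ValidForcing G (NonForcing G fs) (reverseForces S)
    suffix P [] _ = tt
    suffix P ((u , v) ∷ S) eq =
      valid-++ (reverseForces S) _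
        (suffix (P ++ (u , v) ∷ []) S (trans eq (sym (++-assoc P _ S))))
        (valid-singleton (reverse-canForce P S eq valid))

  allBlue-source : ∀ {A : Arcs n} {fs} → (∀ u v → A u v ⇔ ((u , v) ∈ fs)) → AllBlue G (Source G A) fs
  allBlue-source {fs = fs} arcs⇔ x vx with forced? x fs
  ... | yes f       = inj₂ f
  ... | no unforced = inj₁ (vx , λ u a → unforced (u , to (arcs⇔ u x) a))

  -- Membership in S need not be decidable, which is why B′ has to be stable.
  lift-valid : ∀ {S B B′ : VSet n} fs →
               B ⊆ B′ → (∀ {x} → V G x → S x → B′ x → B x) → StableOn (V G) B′ →
               (∀ {u v w} → (u , v) ∈ fs → E G u w → ¬ S w → B′ w) →
               ValidForcing (G [ S ]) B fs → ValidForcing G B′ fs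
  lift-valid [] _ _ _ _ _ = tt
  lift-valid ((u , v) ∷ fs) B⊆B′ B′⊆B stable outside (bu , ¬bv , (e , su , sv) , nbrs , rest) =
    B⊆B′ bu , ¬bv ∘ B′⊆B (E-V G (E-sym G e)) sv , e ,
    (λ w e′ w≢v → stable w (E-V G (E-sym G e′)) λ ¬bw →
       ¬bw (outside (here refl) e′ λ sw → ¬bw (B⊆B′ (nbrs w (e′ , su , sw) w≢v)))) ,
    lift-valid fs (λ {x} → ⊎-map₁ (B⊆B′ {x})) (λ {x} vx sx → ⊎-map₁ (B′⊆B {x} vx sx))
      (stable-∪≡ stable) (λ m e′ ¬sw → inj₁ (outside (there m) e′ ¬sw)) rest

module Gluing {n : ℕ} (G : Graph n) (C : VSet n) (r : Fin n) where

  V₁ V₂ S₁ S₂ : VSet n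
  V₁ = Component (G ─ C) r
  V₂ x = V G x × ¬ V₁ x × ¬ C x
  S₁ = V₁ ∪ C
  S₂ = V₂ ∪ C

  G₁ G₂ : Graph n
  G₁ = G [ S₁ ]
  G₂ = G [ S₂ ]

  V₁-closed : ∀ {w v} → V₁ w → E G w v → ¬ C v → V₁ v
  V₁-closed ((_ , ¬cw) , path) e ¬cv = (E-V G (E-sym G e) , ¬cv) , path ◅◅ ((e , ¬cw , ¬cv) ◅ ε)

  V₁⇒¬S₂ : ∀ {x} → V₁ x → ¬ S₂ x
  V₁⇒¬S₂ v₁ (inj₁ (_ , ¬v₁ , _)) = ¬v₁ v₁
  V₁⇒¬S₂ v₁ (inj₂ c)             = proj₂ (proj₁ v₁) c

  V₂⇒¬S₁ : ∀ {x} → V₂ x → ¬ S₁ x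
  V₂⇒¬S₁ (_ , ¬v₁ , ¬c) = [ ¬v₁ , ¬c ]′

  S₁∩S₂⊆C : ∀ {x} → S₁ x → S₂ x → C x
  S₁∩S₂⊆C (inj₁ v₁) s₂ = ⊥-elim (V₁⇒¬S₂ v₁ s₂)
  S₁∩S₂⊆C (inj₂ c)  _  = c

  V₂-nbrs⊆S₂ : ∀ {u w} → V₂ u → E G u w → ¬ ¬ S₂ w
  V₂-nbrs⊆S₂ (_ , ¬v₁u , ¬cu) e ¬s₂w =
    ¬s₂w (inj₁ (E-V G (E-sym G e) , (λ v₁w → ¬v₁u (V₁-closed v₁w (E-sym G e) ¬cu)) , ¬s₂w ∘ inj₂))

  module Union (A₁ A₂ : Arcs n) (arcs₁ : IsArcSet G₁ A₁) (arcs₂ : IsArcSet G₂ A₂)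
           (C-source : ∀ c → C c → Source G₁ A₁ c × Source G₂ A₂ c) where

    A : Arcs n
    A = A₁ ∪A rev A₂

    tail₁ : ∀ {a b} → A₁ a b → S₁ a
    tail₁ {a} {b} arc = proj₁ (proj₂ (proj₁ (arcs₁ a b arc)))

    tail₂ : ∀ {a b} → A₂ a b → S₂ a
    tail₂ {a} {b} arc = proj₁ (proj₂ (proj₁ (arcs₂ a b arc)))

    head₁ : ∀ {a b} → A₁ a b → V₁ b
    head₁ {a} {b} arc with proj₂ (proj₂ (proj₁ (arcs₁ a b arc)))
    ... | inj₁ v₁ = v₁
    ... | inj₂ c  = ⊥-elim (proj₂ (proj₁ (C-source b c)) a arc)

    head₂ : ∀ {a b} → A₂ a b → V₂ b
    head₂ {a} {b} arc with proj₂ (proj₂ (proj₁ (arcs₂ a b arc)))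
    ... | inj₁ v₂ = v₂
    ... | inj₂ c  = ⊥-elim (proj₂ (proj₂ (C-source b c)) a arc)

    isArcSet : IsArcSet G A
    isArcSet u v (inj₁ a₁) = proj₁ (proj₁ (arcs₁ u v a₁)) , λ
      { (inj₁ b₁) → proj₂ (arcs₁ u v a₁) b₁
      ; (inj₂ b₂) → V₁⇒¬S₂ (head₁ a₁) (inj₁ (head₂ b₂)) }
    isArcSet u v (inj₂ a₂) = E-sym G (proj₁ (proj₁ (arcs₂ v u a₂))) , λ
      { (inj₁ b₁) → V₁⇒¬S₂ (head₁ b₁) (inj₁ (head₂ a₂))
      ; (inj₂ b₂) → proj₂ (arcs₂ v u a₂) b₂ }

    arc-from-V₁ : ∀ {x y} → A x y → V₁ x → A₁ x y
    arc-from-V₁ (inj₁ a₁) _  = a₁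
    arc-from-V₁ (inj₂ a₂) v₁ = ⊥-elim (V₁⇒¬S₂ v₁ (inj₁ (head₂ a₂)))

    path-from-V₁ : ∀ {x y} → TransClosure A x y → V₁ x → TransClosure A₁ x y
    path-from-V₁ [ a ]⁺     v₁ = [ arc-from-V₁ a v₁ ]⁺
    path-from-V₁ (a ∷⁺ p) v₁ = arc-from-V₁ a v₁ ∷⁺ path-from-V₁ p (head₁ (arc-from-V₁ a v₁))

    V₁-trapped : ∀ {x y} → TransClosure A x y → V₁ x → V₁ y
    V₁-trapped [ a ]⁺     v₁ = head₁ (arc-from-V₁ a v₁)
    V₁-trapped (a ∷⁺ p) v₁ = V₁-trapped p (head₁ (arc-from-V₁ a v₁))

    path-into-V₂ : ∀ {x y} → TransClosure A x y → V₂ y → TransClosure A₂ y x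
    path-into-V₂ [ inj₁ a₁ ]⁺     v₂ = ⊥-elim (V₁⇒¬S₂ (head₁ a₁) (inj₁ v₂))
    path-into-V₂ [ inj₂ a₂ ]⁺     _  = [ a₂ ]⁺
    path-into-V₂ (inj₁ a₁ ∷⁺ p) v₂ = ⊥-elim (V₁⇒¬S₂ (V₁-trapped p (head₁ a₁)) (inj₁ v₂))
    path-into-V₂ (inj₂ a₂ ∷⁺ p) v₂ = path-into-V₂ p v₂ ∷ʳ a₂

    isPathCollection : IsPathCollection A₁ → IsPathCollection A₂ → IsPathCollection A
    isPathCollection (in₁ , out₁ , acyclic₁) (in₂ , out₂ , acyclic₂) = inUnique , outUnique , acyclic
      where
      inUnique : ∀ u u′ v → A u v → A u′ v → u ≡ u′
      inUnique u u′ v (inj₁ a₁) (inj₁ b₁) = in₁ u u′ v a₁ b₁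
      inUnique u u′ v (inj₂ a₂) (inj₂ b₂) = out₂ v u u′ a₂ b₂
      inUnique _ _  _ (inj₁ a₁) (inj₂ b₂) = ⊥-elim (V₁⇒¬S₂ (head₁ a₁) (tail₂ b₂))
      inUnique _ _  _ (inj₂ a₂) (inj₁ b₁) = ⊥-elim (V₁⇒¬S₂ (head₁ b₁) (tail₂ a₂))
      outUnique : ∀ u v v′ → A u v → A u v′ → v ≡ v′
      outUnique u v v′ (inj₁ a₁) (inj₁ b₁) = out₁ u v v′ a₁ b₁
      outUnique u v v′ (inj₂ a₂) (inj₂ b₂) = in₂ v v′ u a₂ b₂
      outUnique _ _ _  (inj₁ a₁) (inj₂ b₂) = ⊥-elim (V₂⇒¬S₁ (head₂ b₂) (tail₁ a₁))
      outUnique _ _ _  (inj₂ a₂) (inj₁ b₁) = ⊥-elim (V₂⇒¬S₁ (head₂ a₂) (tail₁ b₁))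
      acyclic : ∀ v → ¬ TransClosure A v v
      acyclic v [ inj₁ a₁ ]⁺     = acyclic₁ v [ a₁ ]⁺
      acyclic v [ inj₂ a₂ ]⁺     = acyclic₂ v [ a₂ ]⁺
      acyclic v (inj₁ a₁ ∷⁺ p) = acyclic₁ v (a₁ ∷⁺ path-from-V₁ p (head₁ a₁))
      acyclic v (inj₂ a₂ ∷⁺ p) = acyclic₂ v (path-into-V₂ (inj₂ a₂ ∷⁺ p) (head₂ a₂))

    module Process (fs₁ fs₂ : ForcingList n)
                   (arcs⇔₁ : ∀ u v → A₁ u v ⇔ ((u , v) ∈ fs₁))
                   (arcs⇔₂ : ∀ u v → A₂ u v ⇔ ((u , v) ∈ fs₂)) where

      fs : ForcingList n
      fs = reverseForces fs₂ ++ fs₁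

      arcs⇔ : ∀ u v → A u v ⇔ ((u , v) ∈ fs)
      arcs⇔ u v = mk⇔
        [ ∈-++⁺ʳ (reverseForces fs₂) ∘ to (arcs⇔₁ u v) , ∈-++⁺ˡ ∘ ∈-reverseForces⁺ ∘ to (arcs⇔₂ v u) ]′
        ([ inj₂ ∘ from (arcs⇔₂ v u) ∘ ∈-reverseForces⁻ fs₂ , inj₁ ∘ from (arcs⇔₁ u v) ]′ ∘ ∈-++⁻ (reverseForces fs₂))

      Blue₁ : VSet n
      Blue₁ = BlueAfter (Source G A) (reverseForces fs₂)

      nonForcing⇒source : NonForcing G₂ fs₂ ⊆ Source G A
      nonForcing⇒source {x} ((vx , s₂x) , idle) = vx , λ
        { u (inj₁ a₁) → V₁⇒¬S₂ (head₁ a₁) s₂x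
        ; u (inj₂ a₂) → idle u (to (arcs⇔₂ x u) a₂) }

      noA₁-in⇒blue₁ : ∀ {x} → V G x → (∀ u → ¬ A₁ u x) → Blue₁ x
      noA₁-in⇒blue₁ {x} vx noIn₁ with forces? x fs₂
      ... | yes (y , m) = inj₂ (y , ∈-reverseForces⁺ m)
      ... | no idle     = inj₁ (vx , λ
        { u (inj₁ a₁) → noIn₁ u a₁
        ; u (inj₂ a₂) → idle (u , to (arcs⇔₂ x u) a₂) })

      blue₁⇒source₁ : ∀ {x} → V G x → S₁ x → Blue₁ x → Source G₁ A₁ x
      blue₁⇒source₁ vx s₁x (inj₁ (_ , noIn)) = (vx , s₁x) , λ u a₁ → noIn u (inj₁ a₁)
      blue₁⇒source₁ {x} vx s₁x (inj₂ (y , m)) =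
        proj₁ (C-source x (S₁∩S₂⊆C s₁x (tail₂ (from (arcs⇔₂ x y) (∈-reverseForces⁻ fs₂ m)))))

      phase₁ : ∀ {B₂} → ValidForcing G₂ B₂ fs₂ → ValidForcing G (Source G A) (reverseForces fs₂)
      phase₁ valid₂ =
        lift-valid (reverseForces fs₂) nonForcing⇒source
          (λ vx s₂x (_ , noIn) → (vx , s₂x) , λ y m → noIn y (inj₂ (from (arcs⇔₂ _ y) m)))
          (stable-source {G = G} {A})
          (λ {u} {v} m e → ⊥-elim ∘ V₂-nbrs⊆S₂ (head₂ (from (arcs⇔₂ v u) (∈-reverseForces⁻ fs₂ m))) e)
          (reverse-valid fs₂ valid₂)

      phase₂ : ValidForcing G₁ (Source G₁ A₁) fs₁ → ValidForcing G Blue₁ fs₁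
      phase₂ =
        lift-valid fs₁ (λ ((vx , _) , noIn₁) → noA₁-in⇒blue₁ vx noIn₁) blue₁⇒source₁
          (stable-blueAfter (stable-source {G = G} {A}))
          (λ _ e ¬s₁w → noA₁-in⇒blue₁ (E-V G (E-sym G e)) λ _ a₁ → ¬s₁w (inj₁ (head₁ a₁)))

proposition3p5 : {n : ℕ} (G : Graph n) (C : VSet n) → IsVertexCut G C →
    (r : Fin n) → V (G ─ C) r →
    let V₁ = Component (G ─ C) r
        V₂ = λ x → V G x × ¬ V₁ x × ¬ C x
        G₁ = G [ (λ x → V₁ x ⊎ C x) ]
        G₂ = G [ (λ x → V₂ x ⊎ C x) ]
    in (A₁ A₂ : Arcs n) → IsForcingArcSet G₁ A₁ → IsForcingArcSet G₂ A₂ →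
       (∀ c → C c → Source G₁ A₁ c × Source G₂ A₂ c) →
       IsForcingArcSet G (A₁ ∪A rev A₂)
proposition3p5 G C _ r _ A₁ A₂ (arcs₁ , paths₁ , fs₁ , valid₁ , _ , arcs⇔₁)
                               (arcs₂ , paths₂ , fs₂ , valid₂ , _ , arcs⇔₂) C-source =
  isArcSet , isPathCollection paths₁ paths₂ ,
  fs , valid-++ (reverseForces fs₂) fs₁ (phase₁ valid₂) (phase₂ valid₁) , allBlue-source {G = G} arcs⇔ , arcs⇔
  where
  open Gluing.Union G C r A₁ A₂ arcs₁ arcs₂ C-source
  open Process fs₁ fs₂ arcs⇔₁ arcs⇔₂
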